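{- Suppose there is an algorithm which takes as input a Diophantine equation and returns an integer such that, whenever the equation has only finitely many integer solutions, this integer is greater than the number of integer solutions. Then there is an algorithm which takes as input a Diophantine equation and returns an integer such that, whenever the equation has only finitely many integer solutions, this integer is greater than the heights of all integer solutions.
   Context: A Diophantine equation is an equation $D(x_1,\ldots,x_n)=0$ with $D \in \mathbb Z[x_1,\ldots,x_n]$. The height of a rational number $\frac{p}{q}$ written in lowest terms is $\max(|p|,|q|)$ (so the height of an integer $a$ is $|a|$). The height of a rational tuple $(x_1,\ldots,x_n)$ is the maximum of $n$ and the heights of $x_1,\ldots,x_n$. -}

module Defs where

open import Data.Nat using (ℕ; _⊔_)
open import Data.Integer as ℤ using (ℤ; ∣_∣)
open import Data.Fin using (Fin)
open import Data.Vec using (Vec; lookup; foldr)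
open import Data.List using (List; length)
open import Data.List.Membership.Propositional using (_∈_)
open import Data.List.Relation.Unary.Unique.Propositional using (Unique)
open import Data.Product using (∃; _×_)
open import Function.Bundles using (_⇔_)
open import Relation.Binary.PropositionalEquality using (_≡_)

data Poly (n : ℕ) : Set where
  const : ℤ → Poly n
  var   : Fin n → Poly n
  _⊕_   : Poly n → Poly n → Poly n
  _⊗_   : Poly n → Poly n → Poly n

record DiophantineEq : Set where
  constructor dioph
  field
    nvars : ℕ
    poly  : Poly nvars
open DiophantineEq public

eval : ∀ {n} → Poly n → Vec ℤ n → ℤ
eval (const c) x = c
eval (var i)   x = lookup x i
eval (p ⊕ q)   x = eval p x ℤ.+ eval q x
eval (p ⊗ q)   x = eval p x ℤ.* eval q x

IsSolution : (E : DiophantineEq) → Vec ℤ (nvars E) → Set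
IsSolution E x = eval (poly E) x ≡ ℤ.0ℤ

Enumerates : (E : DiophantineEq) → List (Vec ℤ (nvars E)) → Set
Enumerates E L = Unique L × (∀ x → IsSolution E x ⇔ x ∈ L)

FinitelyManySolutions : DiophantineEq → Set
FinitelyManySolutions E = ∃ λ L → Enumerates E L

-- height of an integer tuple: max of n and the |xᵢ|
height : ∀ {n} → Vec ℤ n → ℕ
height {n} x = foldr _ (λ a m → ∣ a ∣ ⊔ m) n x

{-# OPTIONS --safe #-}
-- Pad the equation D(x) = 0 in n variables to
--   D(x)² + (x₁² + … + xₙ² + n² − k² − a² − b² − c² − d²)² = 0
-- in n + 5 variables. Its solutions are the tuples (k, a, b, c, d, x) with x a solution of D = 0
-- and k² + a² + b² + c² + d² = |x|² + n², so there are finitely many if D = 0 has finitely many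
-- (every entry is bounded by the largest |x|² + n²). Since height(x)² ≤ |x|² + n², Lagrange's
-- four-square theorem turns every 0 ≤ k ≤ height(x) into such a solution, so the padded equation
-- has more than height(x) solutions, and f applied to it bounds the heights.
-- Lagrange's theorem is proved classically: Euler's identity reduces it to primes p, the
-- pigeonhole principle on squares mod p gives x² + y² + 1 = m p with 0 < m < p, and Euler's
-- descent lowers m to 1.
module Submission where

open import Defs
open import Data.Nat as ℕ using (ℕ; zero; suc; z≤n; s≤s; _⊔_)
import Data.Nat.Properties as ℕ
open import Data.Nat.DivMod using (m≡m%n+[m/n]*n; m%n<n)
open import Data.Nat.Divisibility using (_∣_; divides; ∣m+n∣m⇒∣n; n∣m*n; ∣⇒≤; quotient-<; hasNonTrivialDivisor)
open import Data.Nat.Primality using (Prime; euclidsLemma; prime⇒nonZero; prime⇒nonTrivial; prime⇒irreducible; composite?; ¬composite⇒prime)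
open import Data.Nat.Induction using (<-wellFounded)
open import Data.Nat.ListAction using (sum)
import Data.Nat.Tactic.RingSolver as ℕ-Solver
open import Data.Integer as ℤ using (ℤ; +_; -[1+_]; ∣_∣)
import Data.Integer.Properties as ℤ
open import Data.Integer.DivMod using (_%ℕ_; _/ℕ_; a≡a%ℕn+[a/ℕn]*n; n%ℕd<d)
open import Data.Integer.Tactic.RingSolver using (solve-∀)
open import Data.Fin as Fin using (Fin; toℕ; fromℕ<; splitAt; join; _↑ˡ_; _↑ʳ_)
import Data.Fin.Properties as Fin
open import Data.Vec as Vec using (Vec; []; _∷_; _++_; lookup; foldr)
import Data.Vec.Properties as Vec
open import Data.Vec.Relation.Unary.All as All using (All; []; _∷_)
import Data.Vec.Relation.Unary.All.Properties as All
open import Data.List as List using (List; length; upTo; map; filter; deduplicate; cartesianProductWith)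
open import Data.List.Membership.Propositional using (_∈_)
import Data.List.Membership.Propositional.Properties as ∈
open import Data.List.Relation.Unary.Any as Any using (here; there)
import Data.List.Relation.Unary.Any.Properties as Any
import Data.List.Relation.Unary.Unique.DecPropositional.Properties as Unique
open import Data.Product using (Σ; _×_; _,_; proj₁; proj₂)
open import Data.Sum using (_⊎_; inj₁; inj₂)
open import Data.Empty using (⊥-elim)
open import Function using (_∘_)
open import Function.Bundles using (_⇔_; mk⇔; Equivalence)
open import Induction.WellFounded using (Acc; acc)
open import Relation.Binary.Definitions using (DecidableEquality; tri<; tri≈; tri>)
open import Relation.Binary.PropositionalEquality
open import Relation.Nullary using (¬_; Dec; yes; no)

-- Lagrange's four-square theorem

module _ where
  open import Data.Nat using (_+_; _*_; _∸_; _≤_; _<_; _%_; _/_; ⌊_/2⌋; ⌈_/2⌉; NonZero)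

  %≡%⇒∣ : ∀ {d} .{{_ : NonZero d}} m n → m % d ≡ (m + n) % d → d ∣ n
  %≡%⇒∣ {d} m n eq = ∣m+n∣m⇒∣n (subst (d ∣_) (sym Ad+n≡Bd) (n∣m*n B)) (n∣m*n A)
    where
    A B : ℕ
    A = m / d
    B = (m + n) / d
    Ad+n≡Bd : A * d + n ≡ B * d
    Ad+n≡Bd = ℕ.+-cancelˡ-≡ (m % d) _ _ (begin
      m % d + (A * d + n)     ≡⟨ sym (ℕ.+-assoc (m % d) _ n) ⟩
      m % d + A * d + n       ≡⟨ cong (_+ n) (sym (m≡m%n+[m/n]*n m d)) ⟩
      m + n                   ≡⟨ m≡m%n+[m/n]*n (m + n) d ⟩
      (m + n) % d + B * d     ≡⟨ cong (_+ B * d) (sym eq) ⟩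
      m % d + B * d           ∎)
      where open ≡-Reasoning

  %+%≡⇒∣ : ∀ {d} .{{_ : NonZero d}} m n → m % d + suc (n % d) ≡ d → d ∣ m + n + 1
  %+%≡⇒∣ {d} m n eq = divides (suc (m / d + n / d)) (begin
    m + n + 1                                     ≡⟨ cong₂ (λ u v → u + v + 1) (m≡m%n+[m/n]*n m d) (m≡m%n+[m/n]*n n d) ⟩
    m % d + m / d * d + (n % d + n / d * d) + 1   ≡⟨ regroup (m % d) (n % d) (m / d) (n / d) d ⟩
    m % d + suc (n % d) + (m / d + n / d) * d     ≡⟨ cong (_+ (m / d + n / d) * d) eq ⟩
    suc (m / d + n / d) * d                       ∎)
    where
    open ≡-Reasoning
    regroup : ∀ r s a b d → r + a * d + (s + b * d) + 1 ≡ r + suc s + (a + b) * d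
    regroup = ℕ-Solver.solve-∀

  ⌈n/2⌉≤1+⌊n/2⌋ : ∀ n → ⌈ n /2⌉ ≤ suc ⌊ n /2⌋
  ⌈n/2⌉≤1+⌊n/2⌋ zero          = z≤n
  ⌈n/2⌉≤1+⌊n/2⌋ (suc zero)    = s≤s z≤n
  ⌈n/2⌉≤1+⌊n/2⌋ (suc (suc n)) = s≤s (⌈n/2⌉≤1+⌊n/2⌋ n)

  n≤n*n : ∀ n → n ≤ n * n
  n≤n*n zero    = z≤n
  n≤n*n (suc n) = ℕ.m≤m*n (suc n) (suc n)

  square-injective : ∀ {u v} → u * u ≡ v * v → u ≡ v
  square-injective {u} {v} eq with ℕ.<-cmp u v
  ... | tri< u<v _ _ = ⊥-elim (ℕ.<-irrefl eq (ℕ.*-mono-< u<v u<v))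
  ... | tri≈ _ u≡v _ = u≡v
  ... | tri> _ _ v<u = ⊥-elim (ℕ.<-irrefl (sym eq) (ℕ.*-mono-< v<u v<u))

  square-of-double : ∀ a → (a + a) * (a + a) ≡ a * a * 4
  square-of-double = ℕ-Solver.solve-∀

  double≤⇒4*square≤ : ∀ {a M} → a + a ≤ M → a * a * 4 ≤ M * M
  double≤⇒4*square≤ {a} {M} 2a≤M = subst (_≤ M * M) (square-of-double a) (ℕ.*-mono-≤ 2a≤M 2a≤M)

  4*square≡⇒double≡ : ∀ {a M} → a * a * 4 ≡ M * M → a + a ≡ M
  4*square≡⇒double≡ {a} eq = square-injective (trans (square-of-double a) eq)

  ⊔-square≤ : ∀ p q → (p ⊔ q) * (p ⊔ q) ≤ p * p + q * q
  ⊔-square≤ p q with ℕ.⊔-sel p q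
  ... | inj₁ p⊔q≡p rewrite p⊔q≡p = ℕ.m≤m+n (p * p) (q * q)
  ... | inj₂ p⊔q≡q rewrite p⊔q≡q = ℕ.m≤n+m (q * q) (p * p)

  quarters≤⇒sum≤ : ∀ a b c d {B} → a * 4 ≤ B → b * 4 ≤ B → c * 4 ≤ B → d * 4 ≤ B → a + b + c + d ≤ B
  quarters≤⇒sum≤ a b c d {B} a≤ b≤ c≤ d≤ = ℕ.*-cancelʳ-≤ _ B 4
    (subst₂ _≤_ (distrib a b c d) (four-times B) (ℕ.+-mono-≤ (ℕ.+-mono-≤ (ℕ.+-mono-≤ a≤ b≤) c≤) d≤))
    where
    distrib : ∀ a b c d → a * 4 + b * 4 + c * 4 + d * 4 ≡ (a + b + c + d) * 4
    distrib = ℕ-Solver.solve-∀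
    four-times : ∀ B → B + B + B + B ≡ B * 4
    four-times = ℕ-Solver.solve-∀

  quarters≤∧sum≡⇒quarter≡ : ∀ a b c d {B} → a * 4 ≤ B → b * 4 ≤ B → c * 4 ≤ B → d * 4 ≤ B →
    a + b + c + d ≡ B → a * 4 ≡ B
  quarters≤∧sum≡⇒quarter≡ a b c d {B} a≤ b≤ c≤ d≤ sum≡ =
    ℕ.≤-antisym a≤ (ℕ.+-cancelʳ-≤ (B * 3) B (a * 4) (begin
      B + B * 3                           ≡⟨ cong (λ t → t + t * 3) (sym sum≡) ⟩
      S + S * 3                           ≡⟨ regroup a b c d ⟩
      a * 4 + (b * 4 + c * 4 + d * 4)     ≤⟨ ℕ.+-monoʳ-≤ (a * 4) rest≤ ⟩
      a * 4 + B * 3                       ∎))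
    where
    open ℕ.≤-Reasoning
    S : ℕ
    S = a + b + c + d
    regroup : ∀ a b c d → let S = a + b + c + d in S + S * 3 ≡ a * 4 + (b * 4 + c * 4 + d * 4)
    regroup = ℕ-Solver.solve-∀
    three-times : ∀ B → B + B + B ≡ B * 3
    three-times = ℕ-Solver.solve-∀
    rest≤ : b * 4 + c * 4 + d * 4 ≤ B * 3
    rest≤ = subst (b * 4 + c * 4 + d * 4 ≤_) (three-times B) (ℕ.+-mono-≤ (ℕ.+-mono-≤ b≤ c≤) d≤)

  quarters≤∧sum≡⇒quarters≡ : ∀ a b c d {B} → a * 4 ≤ B → b * 4 ≤ B → c * 4 ≤ B → d * 4 ≤ B →
    a + b + c + d ≡ B → a * 4 ≡ B × b * 4 ≡ B × c * 4 ≡ B × d * 4 ≡ B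
  quarters≤∧sum≡⇒quarters≡ a b c d a≤ b≤ c≤ d≤ sum≡ =
    quarters≤∧sum≡⇒quarter≡ a b c d a≤ b≤ c≤ d≤ sum≡ ,
    quarters≤∧sum≡⇒quarter≡ b a c d b≤ a≤ c≤ d≤ (trans (swap-b a b c d) sum≡) ,
    quarters≤∧sum≡⇒quarter≡ c a b d c≤ a≤ b≤ d≤ (trans (swap-c a b c d) sum≡) ,
    quarters≤∧sum≡⇒quarter≡ d a b c d≤ a≤ b≤ c≤ (trans (swap-d a b c d) sum≡)
    where
    swap-b : ∀ a b c d → b + a + c + d ≡ a + b + c + d
    swap-b = ℕ-Solver.solve-∀
    swap-c : ∀ a b c d → c + a + b + d ≡ a + b + c + d
    swap-c = ℕ-Solver.solve-∀
    swap-d : ∀ a b c d → d + a + b + c ≡ a + b + c + d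
    swap-d = ℕ-Solver.solve-∀

  sumOfSquares≡0 : ∀ a b c d → a * a + b * b + c * c + d * d ≡ 0 → a ≡ 0 × b ≡ 0 × c ≡ 0 × d ≡ 0
  sumOfSquares≡0 zero    zero    zero    zero    _ = refl , refl , refl , refl
  sumOfSquares≡0 (suc a) b       c       d       ()
  sumOfSquares≡0 zero    (suc b) c       d       ()
  sumOfSquares≡0 zero    zero    (suc c) d       ()
  sumOfSquares≡0 zero    zero    zero    (suc d) ()

  record SmallMultiple (p : ℕ) : Set where
    constructor smallMultiple
    field
      x y m : ℕ
      0<m : 0 < m
      m<p : m < p
      x²+y²+1≡mp : x * x + y * y + 1 ≡ m * p

  module _ {p : ℕ} (p-prime : Prime p) where
    private instance
      p≢0 : NonZero p
      p≢0 = prime⇒nonZero p-prime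

    ¬∣-between : ∀ {n} → 0 < n → n < p → ¬ (p ∣ n)
    ¬∣-between 0<n n<p p∣n = ℕ.<⇒≱ n<p (∣⇒≤ {{ℕ.>-nonZero 0<n}} p∣n)

    squares-mod-distinct : ∀ {x x′} → x < x′ → x + x′ < p → (x * x) % p ≢ (x′ * x′) % p
    squares-mod-distinct {x} {x′} x<x′ x+x′<p eq
      with euclidsLemma (x′ ∸ x) (x + x′) p-prime (%≡%⇒∣ (x * x) _ (subst (λ z → (x * x) % p ≡ z % p) x′²≡ eq))
      where
      difference-of-squares : ∀ x d → (x + d) * (x + d) ≡ x * x + d * (x + (x + d))
      difference-of-squares = ℕ-Solver.solve-∀
      x′²≡ : x′ * x′ ≡ x * x + (x′ ∸ x) * (x + x′)
      x′²≡ = subst (λ y → y * y ≡ x * x + (x′ ∸ x) * (x + y)) (ℕ.m+[n∸m]≡n (ℕ.<⇒≤ x<x′))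
               (difference-of-squares x (x′ ∸ x))
    ... | inj₁ p∣x′-x = ¬∣-between (ℕ.m<n⇒0<n∸m x<x′)
            (ℕ.≤-<-trans (ℕ.m∸n≤m x′ x) (ℕ.≤-<-trans (ℕ.m≤n+m x′ x) x+x′<p)) p∣x′-x
    ... | inj₂ p∣x+x′ = ¬∣-between (ℕ.<-≤-trans (s≤s z≤n) (ℕ.≤-trans x<x′ (ℕ.m≤n+m x′ x))) x+x′<p p∣x+x′

    private
      h : ℕ
      h = ⌊ p /2⌋

      h+h≤p : h + h ≤ p
      h+h≤p = subst (h + h ≤_) (ℕ.⌊n/2⌋+⌈n/2⌉≡n p) (ℕ.+-monoʳ-≤ h (ℕ.⌊n/2⌋≤⌈n/2⌉ p))

      p<2+h+h : p < suc h + suc h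
      p<2+h+h = begin-strict
        p                  ≡⟨ sym (ℕ.⌊n/2⌋+⌈n/2⌉≡n p) ⟩
        h + ⌈ p /2⌉        ≤⟨ ℕ.+-monoʳ-≤ h (⌈n/2⌉≤1+⌊n/2⌋ p) ⟩
        h + suc h          <⟨ ℕ.n<1+n _ ⟩
        suc h + suc h      ∎
        where open ℕ.≤-Reasoning

      1≤h : 1 ≤ h
      1≤h = ℕ.⌊n/2⌋-mono (ℕ.nonTrivial⇒n>1 p {{prime⇒nonTrivial p-prime}})

      sum<p : ∀ {u v} → u < v → v ≤ h → u + v < p
      sum<p {u} {v} u<v v≤h = ℕ.<-≤-trans (ℕ.+-monoˡ-< v u<v) (ℕ.≤-trans (ℕ.+-mono-≤ v≤h v≤h) h+h≤p)

      toℕ≤h : (x : Fin (suc h)) → toℕ x ≤ h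
      toℕ≤h = Fin.toℕ≤pred[n]

    squares-mod-injective : ∀ {x x′} → x ≤ h → x′ ≤ h → (x * x) % p ≡ (x′ * x′) % p → x ≡ x′
    squares-mod-injective {x} {x′} x≤h x′≤h eq with ℕ.<-cmp x x′
    ... | tri< x<x′ _ _ = ⊥-elim (squares-mod-distinct x<x′ (sum<p x<x′ x′≤h) eq)
    ... | tri≈ _ x≡x′ _ = x≡x′
    ... | tri> _ _ x′<x = ⊥-elim (squares-mod-distinct x′<x (sum<p x′<x x≤h) (sym eq))

    sumOfTwoSquares+1<p² : ∀ {x y} → x ≤ h → y ≤ h → x * x + y * y + 1 < p * p
    sumOfTwoSquares+1<p² {x} {y} x≤h y≤h = begin-strict
      x * x + y * y + 1                ≤⟨ ℕ.+-monoˡ-≤ 1 (ℕ.+-mono-≤ (ℕ.*-mono-≤ x≤h x≤h) (ℕ.*-mono-≤ y≤h y≤h)) ⟩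
      h * h + h * h + 1                <⟨ ℕ.+-monoʳ-< (h * h + h * h) (ℕ.+-mono-≤ 1≤h² 1≤h²) ⟩
      h * h + h * h + (h * h + h * h)  ≡⟨ regroup h ⟩
      (h + h) * (h + h)                ≤⟨ ℕ.*-mono-≤ h+h≤p h+h≤p ⟩
      p * p                            ∎
      where
      open ℕ.≤-Reasoning
      1≤h² : 1 ≤ h * h
      1≤h² = ℕ.*-mono-≤ 1≤h 1≤h
      regroup : ∀ h → h * h + h * h + (h * h + h * h) ≡ (h + h) * (h + h)
      regroup = ℕ-Solver.solve-∀

    smallMultiple-from : ∀ {x y} → x ≤ h → y ≤ h → p ∣ x * x + y * y + 1 → SmallMultiple p
    smallMultiple-from {x} {y} x≤h y≤h (divides m eq) = smallMultiple x y m 0<m m<p eq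
      where
      0<m : 0 < m
      0<m = ℕ.n≢0⇒n>0 (λ m≡0 → ℕ.1+n≢0 (ℕ.m+n≡0⇒n≡0 (x * x + y * y) (trans eq (cong (_* p) m≡0))))
      m<p : m < p
      m<p = ℕ.*-cancelʳ-< p m p (subst (_< p * p) eq (sumOfTwoSquares+1<p² x≤h y≤h))

    private
      residue : Fin (suc h) ⊎ Fin (suc h) → ℕ
      residue (inj₁ x) = (toℕ x * toℕ x) % p
      residue (inj₂ y) = p ∸ suc ((toℕ y * toℕ y) % p)

      residue<p : ∀ s → residue s < p
      residue<p (inj₁ x) = m%n<n _ p
      residue<p (inj₂ y) = ℕ.∸-monoʳ-< (s≤s z≤n) (m%n<n _ p)

      residue-collision : ∀ s t → s ≢ t → residue s ≡ residue t → SmallMultiple p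
      residue-collision (inj₁ x) (inj₁ x′) s≢t eq =
        ⊥-elim (s≢t (cong inj₁ (Fin.toℕ-injective (squares-mod-injective (toℕ≤h x) (toℕ≤h x′) eq))))
      residue-collision (inj₂ y) (inj₂ y′) s≢t eq =
        ⊥-elim (s≢t (cong inj₂ (Fin.toℕ-injective (squares-mod-injective (toℕ≤h y) (toℕ≤h y′)
          (ℕ.suc-injective (ℕ.∸-cancelˡ-≡ (m%n<n _ p) (m%n<n _ p) eq))))))
      residue-collision (inj₁ x) (inj₂ y) _ eq = smallMultiple-from (toℕ≤h x) (toℕ≤h y)
        (%+%≡⇒∣ _ _ (trans (cong (_+ _) eq) (ℕ.m∸n+n≡m (m%n<n _ p))))
      residue-collision (inj₂ y) (inj₁ x) _ eq = smallMultiple-from (toℕ≤h x) (toℕ≤h y)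
        (%+%≡⇒∣ _ _ (trans (cong (_+ _) (sym eq)) (ℕ.m∸n+n≡m (m%n<n _ p))))

    -- pigeonhole on the 2(h + 1) > p residues of x² and −1 − y² for 0 ≤ x, y ≤ h
    smallMultiple-of-prime : SmallMultiple p
    smallMultiple-of-prime
      with i , j , i<j , fi≡fj ← Fin.pigeonhole p<2+h+h (λ i → fromℕ< (residue<p (splitAt (suc h) i)))
      = residue-collision (splitAt (suc h) i) (splitAt (suc h) j)
          (λ eq → ℕ.<-irrefl (cong toℕ (splitAt-injective eq)) i<j)
          (trans (sym (Fin.toℕ-fromℕ< _)) (trans (cong toℕ fi≡fj) (Fin.toℕ-fromℕ< _)))
      where
      splitAt-injective : ∀ {i j} → splitAt (suc h) {suc h} i ≡ splitAt (suc h) j → i ≡ j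
      splitAt-injective {i} {j} eq = trans (sym (Fin.join-splitAt (suc h) (suc h) i))
        (trans (cong (join (suc h) (suc h)) eq) (Fin.join-splitAt (suc h) (suc h) j))

open import Data.Integer using (_+_; _*_; _-_; -_; _⊖_; _<_)

sumSq₄ : ℤ → ℤ → ℤ → ℤ → ℤ
sumSq₄ a b c d = a * a + b * b + c * c + d * d

record FourSquares (n : ℤ) : Set where
  constructor fourSquares
  field
    a b c d : ℤ
    sumSq₄≡ : sumSq₄ a b c d ≡ n

euler-four-square-identity : ∀ a₁ a₂ a₃ a₄ b₁ b₂ b₃ b₄ →
  (a₁ * a₁ + a₂ * a₂ + a₃ * a₃ + a₄ * a₄) * (b₁ * b₁ + b₂ * b₂ + b₃ * b₃ + b₄ * b₄)
  ≡ (a₁ * b₁ + a₂ * b₂ + a₃ * b₃ + a₄ * b₄) * (a₁ * b₁ + a₂ * b₂ + a₃ * b₃ + a₄ * b₄)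
  + (a₁ * b₂ - a₂ * b₁ + a₃ * b₄ - a₄ * b₃) * (a₁ * b₂ - a₂ * b₁ + a₃ * b₄ - a₄ * b₃)
  + (a₁ * b₃ - a₃ * b₁ + a₄ * b₂ - a₂ * b₄) * (a₁ * b₃ - a₃ * b₁ + a₄ * b₂ - a₂ * b₄)
  + (a₁ * b₄ - a₄ * b₁ + a₂ * b₃ - a₃ * b₂) * (a₁ * b₄ - a₄ * b₁ + a₂ * b₃ - a₃ * b₂)
euler-four-square-identity = solve-∀

fourSquares-* : ∀ {m n} → FourSquares m → FourSquares n → FourSquares (m * n)
fourSquares-* (fourSquares a₁ a₂ a₃ a₄ refl) (fourSquares b₁ b₂ b₃ b₄ refl) =
  fourSquares (a₁ * b₁ + a₂ * b₂ + a₃ * b₃ + a₄ * b₄) (a₁ * b₂ - a₂ * b₁ + a₃ * b₄ - a₄ * b₃)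
              (a₁ * b₃ - a₃ * b₁ + a₄ * b₂ - a₂ * b₄) (a₁ * b₄ - a₄ * b₁ + a₂ * b₃ - a₃ * b₂)
    (sym (euler-four-square-identity a₁ a₂ a₃ a₄ b₁ b₂ b₃ b₄))

i*i≡∣i∣*∣i∣ : ∀ i → i * i ≡ + (∣ i ∣ ℕ.* ∣ i ∣)
i*i≡∣i∣*∣i∣ (+ n)    = sym (ℤ.pos-* n n)
i*i≡∣i∣*∣i∣ -[1+ n ] = refl

sumSq₄-abs : ∀ a b c d →
  sumSq₄ a b c d ≡ + (∣ a ∣ ℕ.* ∣ a ∣ ℕ.+ ∣ b ∣ ℕ.* ∣ b ∣ ℕ.+ ∣ c ∣ ℕ.* ∣ c ∣ ℕ.+ ∣ d ∣ ℕ.* ∣ d ∣)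
sumSq₄-abs a b c d = begin
  a * a + b * b + c * c + d * d
    ≡⟨ cong₂ _+_ (cong₂ _+_ (cong₂ _+_ (i*i≡∣i∣*∣i∣ a) (i*i≡∣i∣*∣i∣ b)) (i*i≡∣i∣*∣i∣ c)) (i*i≡∣i∣*∣i∣ d) ⟩
  + A + + B + + C + + D
    ≡⟨ cong (λ z → z + + C + + D) (sym (ℤ.pos-+ A B)) ⟩
  + (A ℕ.+ B) + + C + + D
    ≡⟨ cong (_+ + D) (sym (ℤ.pos-+ (A ℕ.+ B) C)) ⟩
  + (A ℕ.+ B ℕ.+ C) + + D
    ≡⟨ sym (ℤ.pos-+ (A ℕ.+ B ℕ.+ C) D) ⟩
  + (A ℕ.+ B ℕ.+ C ℕ.+ D) ∎
  where
  open ≡-Reasoning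
  A B C D : ℕ
  A = ∣ a ∣ ℕ.* ∣ a ∣
  B = ∣ b ∣ ℕ.* ∣ b ∣
  C = ∣ c ∣ ℕ.* ∣ c ∣
  D = ∣ d ∣ ℕ.* ∣ d ∣

record BalancedDivision (y : ℤ) (m : ℕ) : Set where
  constructor balancedDivision
  field
    quotient remainder : ℤ
    y≡ : y ≡ quotient * + m + remainder
    2∣r∣≤m : ∣ remainder ∣ ℕ.+ ∣ remainder ∣ ℕ.≤ m

balancedDivide : ∀ y m .{{_ : ℕ.NonZero m}} → BalancedDivision y m
balancedDivide y m = balance (y /ℕ m) (y %ℕ m) (a≡a%ℕn+[a/ℕn]*n y m) (n%ℕd<d y m)
  where
  carry : ∀ r q m → r + q * m ≡ (q + + 1) * m + (r - m)
  carry = solve-∀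

  balance : ∀ q r → y ≡ + r + q * + m → r ℕ.< m → BalancedDivision y m
  balance q r y≡ r<m with r ℕ.+ r ℕ.≤? m
  ... | yes 2r≤m = balancedDivision q (+ r) (trans y≡ (ℤ.+-comm (+ r) (q * + m))) 2r≤m
  ... | no 2r≰m = balancedDivision (q + + 1) (r ⊖ m)
        (trans y≡ (trans (carry (+ r) q (+ m)) (cong (ℤ._+_ ((q + + 1) * + m)) (ℤ.m-n≡m⊖n r m))))
        (subst (λ t → t ℕ.+ t ℕ.≤ m) (sym (ℤ.∣⊖∣-< r<m)) 2t≤m)
    where
    t : ℕ
    t = m ℕ.∸ r
    t+r≡m : t ℕ.+ r ≡ m
    t+r≡m = ℕ.m∸n+n≡m (ℕ.<⇒≤ r<m)
    t≤r : t ℕ.≤ r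
    t≤r = ℕ.+-cancelʳ-≤ r t r (subst (ℕ._≤ r ℕ.+ r) (sym t+r≡m) (ℕ.<⇒≤ (ℕ.≰⇒> 2r≰m)))
    2t≤m : t ℕ.+ t ℕ.≤ m
    2t≤m = subst (t ℕ.+ t ℕ.≤_) t+r≡m (ℕ.+-monoʳ-≤ t t≤r)

sign-decomposition : ∀ z → Σ ℤ λ e → (z ≡ + ∣ z ∣ * e) × (e * e ≡ + 1)
sign-decomposition (+ n) = + 1 , sym (ℤ.*-identityʳ (+ n)) , refl
sign-decomposition -[1+ n ] = -[1+ 0 ] , cong -[1+_] (sym (ℕ.*-identityʳ n)) , refl

∣z∣+∣z∣≡M⇒z+z≡±M : ∀ {z M} → ∣ z ∣ ℕ.+ ∣ z ∣ ≡ M → Σ ℤ λ e → (z + z ≡ + M * e) × (e * e ≡ + 1)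
∣z∣+∣z∣≡M⇒z+z≡±M {z} refl with e , z≡∣z∣e , e²≡1 ← sign-decomposition z = e , z+z≡ , e²≡1
  where
  open ≡-Reasoning
  z+z≡ : z + z ≡ + (∣ z ∣ ℕ.+ ∣ z ∣) * e
  z+z≡ = begin
    z + z                         ≡⟨ cong₂ _+_ z≡∣z∣e z≡∣z∣e ⟩
    + ∣ z ∣ * e + + ∣ z ∣ * e     ≡⟨ sym (ℤ.*-distribʳ-+ e (+ ∣ z ∣) (+ ∣ z ∣)) ⟩
    (+ ∣ z ∣ + + ∣ z ∣) * e       ≡⟨ cong (_* e) (sym (ℤ.pos-+ ∣ z ∣ ∣ z ∣)) ⟩
    + (∣ z ∣ ℕ.+ ∣ z ∣) * e       ∎

square-of-halfOddMultiple : ∀ q z M e → z + z ≡ M * e → e * e ≡ + 1 →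
  (q * M + z) * (q * M + z) * + 4 ≡ M * M * ((q * q + q * e) * + 4 + + 1)
square-of-halfOddMultiple q z M e z+z≡Me e²≡1 = begin
  (q * M + z) * (q * M + z) * + 4           ≡⟨ doubled q z M ⟩
  (q * M * + 2 + (z + z)) * (q * M * + 2 + (z + z)) ≡⟨ cong (λ w → (q * M * + 2 + w) * (q * M * + 2 + w)) z+z≡Me ⟩
  (q * M * + 2 + M * e) * (q * M * + 2 + M * e) ≡⟨ expand q M e ⟩
  M * M * ((q * q + q * e) * + 4 + e * e)   ≡⟨ cong (λ w → M * M * ((q * q + q * e) * + 4 + w)) e²≡1 ⟩
  M * M * ((q * q + q * e) * + 4 + + 1)     ∎
  where
  open ≡-Reasoning
  doubled : ∀ q z M → (q * M + z) * (q * M + z) * + 4 ≡ (q * M * + 2 + (z + z)) * (q * M * + 2 + (z + z))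
  doubled = solve-∀
  expand : ∀ q M e → (q * M * + 2 + M * e) * (q * M * + 2 + M * e) ≡ M * M * ((q * q + q * e) * + 4 + e * e)
  expand = solve-∀

halfOddMultiples⇒sumSq₄≡M²K : ∀ {M} q₁ q₂ q₃ q₄ {z₁ z₂ z₃ z₄} →
  ∣ z₁ ∣ ℕ.+ ∣ z₁ ∣ ≡ M → ∣ z₂ ∣ ℕ.+ ∣ z₂ ∣ ≡ M → ∣ z₃ ∣ ℕ.+ ∣ z₃ ∣ ≡ M → ∣ z₄ ∣ ℕ.+ ∣ z₄ ∣ ≡ M →
  Σ ℤ λ K → sumSq₄ (q₁ * + M + z₁) (q₂ * + M + z₂) (q₃ * + M + z₃) (q₄ * + M + z₄) ≡ + M * (+ M * K)
halfOddMultiples⇒sumSq₄≡M²K {M} q₁ q₂ q₃ q₄ {z₁} {z₂} {z₃} {z₄} d₁ d₂ d₃ d₄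
  with e₁ , h₁ , s₁ ← ∣z∣+∣z∣≡M⇒z+z≡±M {z₁} d₁
     | e₂ , h₂ , s₂ ← ∣z∣+∣z∣≡M⇒z+z≡±M {z₂} d₂
     | e₃ , h₃ , s₃ ← ∣z∣+∣z∣≡M⇒z+z≡±M {z₃} d₃
     | e₄ , h₄ , s₄ ← ∣z∣+∣z∣≡M⇒z+z≡±M {z₄} d₄
  = a₁ + a₂ + a₃ + a₄ + + 1 , ℤ.*-cancelˡ-≡ (+ 4) _ _ (begin
    + 4 * sumSq₄ y₁ y₂ y₃ y₄
      ≡⟨ distrib y₁ y₂ y₃ y₄ ⟩
    y₁ * y₁ * + 4 + y₂ * y₂ * + 4 + y₃ * y₃ * + 4 + y₄ * y₄ * + 4
      ≡⟨ cong₂ _+_ (cong₂ _+_ (cong₂ _+_ (square-of-halfOddMultiple q₁ z₁ (+ M) e₁ h₁ s₁)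
                                           (square-of-halfOddMultiple q₂ z₂ (+ M) e₂ h₂ s₂))
                                           (square-of-halfOddMultiple q₃ z₃ (+ M) e₃ h₃ s₃))
                                           (square-of-halfOddMultiple q₄ z₄ (+ M) e₄ h₄ s₄) ⟩
    + M * + M * (a₁ * + 4 + + 1) + + M * + M * (a₂ * + 4 + + 1) + + M * + M * (a₃ * + 4 + + 1) + + M * + M * (a₄ * + 4 + + 1)
      ≡⟨ collect (+ M) a₁ a₂ a₃ a₄ ⟩
    + 4 * (+ M * (+ M * (a₁ + a₂ + a₃ + a₄ + + 1))) ∎)
  where
  open ≡-Reasoning
  y₁ y₂ y₃ y₄ a₁ a₂ a₃ a₄ : ℤ
  y₁ = q₁ * + M + z₁
  y₂ = q₂ * + M + z₂
  y₃ = q₃ * + M + z₃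
  y₄ = q₄ * + M + z₄
  a₁ = q₁ * q₁ + q₁ * e₁
  a₂ = q₂ * q₂ + q₂ * e₂
  a₃ = q₃ * q₃ + q₃ * e₃
  a₄ = q₄ * q₄ + q₄ * e₄
  distrib : ∀ a b c d → + 4 * (a * a + b * b + c * c + d * d) ≡ a * a * + 4 + b * b * + 4 + c * c * + 4 + d * d * + 4
  distrib = solve-∀
  collect : ∀ m a b c d → m * m * (a * + 4 + + 1) + m * m * (b * + 4 + + 1) + m * m * (c * + 4 + + 1) + m * m * (d * + 4 + + 1)
                          ≡ + 4 * (m * (m * (a + b + c + d + + 1)))
  collect = solve-∀

descent-identity₁ : ∀ M P q₁ q₂ q₃ q₄ z₁ z₂ z₃ z₄ →
  let y₁ = q₁ * M + z₁
      y₂ = q₂ * M + z₂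
      y₃ = q₃ * M + z₃
      y₄ = q₄ * M + z₄
      R = P - (y₁ * q₁ + y₂ * q₂ + y₃ * q₃ + y₄ * q₄) * + 2 + M * (q₁ * q₁ + q₂ * q₂ + q₃ * q₃ + q₄ * q₄)
  in z₁ * z₁ + z₂ * z₂ + z₃ * z₃ + z₄ * z₄ ≡ M * R + (y₁ * y₁ + y₂ * y₂ + y₃ * y₃ + y₄ * y₄ - M * P)
descent-identity₁ = solve-∀

descent-identity₂ : ∀ M P q₁ q₂ q₃ q₄ z₁ z₂ z₃ z₄ →
  let y₁ = q₁ * M + z₁
      y₂ = q₂ * M + z₂
      y₃ = q₃ * M + z₃
      y₄ = q₄ * M + z₄
      R = P - (y₁ * q₁ + y₂ * q₂ + y₃ * q₃ + y₄ * q₄) * + 2 + M * (q₁ * q₁ + q₂ * q₂ + q₃ * q₃ + q₄ * q₄)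
      V₁ = P - (y₁ * q₁ + y₂ * q₂ + y₃ * q₃ + y₄ * q₄)
      V₂ = y₂ * q₁ - y₁ * q₂ + y₄ * q₃ - y₃ * q₄
      V₃ = y₃ * q₁ - y₁ * q₃ + y₂ * q₄ - y₄ * q₂
      V₄ = y₄ * q₁ - y₁ * q₄ + y₃ * q₂ - y₂ * q₃
  in M * (M * (V₁ * V₁ + V₂ * V₂ + V₃ * V₃ + V₄ * V₄))
     ≡ M * (M * (R * P)) + (y₁ * y₁ + y₂ * y₂ + y₃ * y₃ + y₄ * y₄ - M * P) * (M * M * (q₁ * q₁ + q₂ * q₂ + q₃ * q₃ + q₄ * q₄))
descent-identity₂ = solve-∀

nonNegative-factor : ∀ {M} .{{_ : ℕ.NonZero M}} R {s} → + M * R ≡ + s → Σ ℕ λ r → R ≡ + r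
nonNegative-factor {suc m} (+ r) _ = r , refl
nonNegative-factor {suc m} -[1+ n ] ()

module _ {p : ℕ} (p-prime : Prime p) where
  private
    P : ℤ
    P = + p

  ¬nontrivialFactor : ∀ {M} K → 1 ℕ.< M → M ℕ.< p → P ≢ + M * K
  ¬nontrivialFactor {M} K 1<M M<p P≡MK with prime⇒irreducible p-prime (divides ∣ K ∣ p≡∣K∣M)
    where
    p≡∣K∣M : p ≡ ∣ K ∣ ℕ.* M
    p≡∣K∣M = trans (cong ∣_∣ P≡MK) (trans (ℤ.abs-* (+ M) K) (ℕ.*-comm M ∣ K ∣))
  ... | inj₁ M≡1 = ℕ.<-irrefl (sym M≡1) 1<M
  ... | inj₂ M≡p = ℕ.<-irrefl M≡p M<p

  module DescentStep {M : ℕ} .{{_ : ℕ.NonZero M}} (1<M : 1 ℕ.< M) (M<p : M ℕ.< p)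
    (q₁ q₂ q₃ q₄ z₁ z₂ z₃ z₄ : ℤ)
    (2∣z₁∣≤M : ∣ z₁ ∣ ℕ.+ ∣ z₁ ∣ ℕ.≤ M) (2∣z₂∣≤M : ∣ z₂ ∣ ℕ.+ ∣ z₂ ∣ ℕ.≤ M)
    (2∣z₃∣≤M : ∣ z₃ ∣ ℕ.+ ∣ z₃ ∣ ℕ.≤ M) (2∣z₄∣≤M : ∣ z₄ ∣ ℕ.+ ∣ z₄ ∣ ℕ.≤ M)
    (sumSq₄-y : sumSq₄ (q₁ * + M + z₁) (q₂ * + M + z₂) (q₃ * + M + z₃) (q₄ * + M + z₄) ≡ + M * P)
    where
    y₁ y₂ y₃ y₄ : ℤ
    y₁ = q₁ * + M + z₁
    y₂ = q₂ * + M + z₂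
    y₃ = q₃ * + M + z₃
    y₄ = q₄ * + M + z₄

    R : ℤ
    R = P - (y₁ * q₁ + y₂ * q₂ + y₃ * q₃ + y₄ * q₄) * + 2 + + M * (q₁ * q₁ + q₂ * q₂ + q₃ * q₃ + q₄ * q₄)

    -- (V₁, …, V₄) is the Euler product of (y₁, …, y₄) and (z₁, …, z₄), divided by M
    V₁ V₂ V₃ V₄ : ℤ
    V₁ = P - (y₁ * q₁ + y₂ * q₂ + y₃ * q₃ + y₄ * q₄)
    V₂ = y₂ * q₁ - y₁ * q₂ + y₄ * q₃ - y₃ * q₄
    V₃ = y₃ * q₁ - y₁ * q₃ + y₂ * q₄ - y₄ * q₂
    V₄ = y₄ * q₁ - y₁ * q₄ + y₃ * q₂ - y₂ * q₃

    sumSq₄-y-MP≡0 : sumSq₄ y₁ y₂ y₃ y₄ - + M * P ≡ + 0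
    sumSq₄-y-MP≡0 = trans (cong (_- + M * P) sumSq₄-y) (ℤ.+-inverseʳ (+ M * P))

    sumSq₄-z≡MR : sumSq₄ z₁ z₂ z₃ z₄ ≡ + M * R
    sumSq₄-z≡MR = trans (descent-identity₁ (+ M) P q₁ q₂ q₃ q₄ z₁ z₂ z₃ z₄)
      (trans (cong (ℤ._+_ (+ M * R)) sumSq₄-y-MP≡0) (ℤ.+-identityʳ _))

    sumSq₄-V≡RP : sumSq₄ V₁ V₂ V₃ V₄ ≡ R * P
    sumSq₄-V≡RP = ℤ.*-cancelˡ-≡ (+ M) _ _ (ℤ.*-cancelˡ-≡ (+ M) _ _
      (trans (descent-identity₂ (+ M) P q₁ q₂ q₃ q₄ z₁ z₂ z₃ z₄)
        (trans (cong (λ δ → + M * (+ M * (R * P)) + δ * _) sumSq₄-y-MP≡0) (ℤ.+-identityʳ _))))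

    private
      a₁ a₂ a₃ a₄ : ℕ
      a₁ = ∣ z₁ ∣ ℕ.* ∣ z₁ ∣
      a₂ = ∣ z₂ ∣ ℕ.* ∣ z₂ ∣
      a₃ = ∣ z₃ ∣ ℕ.* ∣ z₃ ∣
      a₄ = ∣ z₄ ∣ ℕ.* ∣ z₄ ∣

      s : ℕ
      s = a₁ ℕ.+ a₂ ℕ.+ a₃ ℕ.+ a₄

      MR≡s : + M * R ≡ + s
      MR≡s = trans (sym sumSq₄-z≡MR) (sumSq₄-abs z₁ z₂ z₃ z₄)

    r : ℕ
    r = proj₁ (nonNegative-factor R MR≡s)

    R≡r : R ≡ + r
    R≡r = proj₂ (nonNegative-factor R MR≡s)

    private
      Mr≡s : M ℕ.* r ≡ s
      Mr≡s = ℤ.+-injective (trans (ℤ.pos-* M r) (trans (cong (+ M *_) (sym R≡r)) MR≡s))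

      4a₁≤M² : a₁ ℕ.* 4 ℕ.≤ M ℕ.* M
      4a₁≤M² = double≤⇒4*square≤ {∣ z₁ ∣} 2∣z₁∣≤M
      4a₂≤M² : a₂ ℕ.* 4 ℕ.≤ M ℕ.* M
      4a₂≤M² = double≤⇒4*square≤ {∣ z₂ ∣} 2∣z₂∣≤M
      4a₃≤M² : a₃ ℕ.* 4 ℕ.≤ M ℕ.* M
      4a₃≤M² = double≤⇒4*square≤ {∣ z₃ ∣} 2∣z₃∣≤M
      4a₄≤M² : a₄ ℕ.* 4 ℕ.≤ M ℕ.* M
      4a₄≤M² = double≤⇒4*square≤ {∣ z₄ ∣} 2∣z₄∣≤M

    r≤M : r ℕ.≤ M
    r≤M = ℕ.*-cancelˡ-≤ M (subst (ℕ._≤ M ℕ.* M) (sym Mr≡s) (quarters≤⇒sum≤ a₁ a₂ a₃ a₄ 4a₁≤M² 4a₂≤M² 4a₃≤M² 4a₄≤M²))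

    r≢0 : r ≢ 0
    r≢0 r≡0 = ¬nontrivialFactor (q₁ * q₁ + q₂ * q₂ + q₃ * q₃ + q₄ * q₄) 1<M M<p (ℤ.*-cancelˡ-≡ (+ M) _ _ (begin
      + M * P                                                          ≡⟨ sym sumSq₄-y ⟩
      sumSq₄ y₁ y₂ y₃ y₄                                               ≡⟨ cong₂ _+_ (cong₂ _+_ (cong₂ _+_ (square q₁ z₁≡0) (square q₂ z₂≡0)) (square q₃ z₃≡0)) (square q₄ z₄≡0) ⟩
      sumSq₄ (q₁ * + M + + 0) (q₂ * + M + + 0) (q₃ * + M + + 0) (q₄ * + M + + 0) ≡⟨ multiples (+ M) q₁ q₂ q₃ q₄ ⟩
      + M * (+ M * (q₁ * q₁ + q₂ * q₂ + q₃ * q₃ + q₄ * q₄))            ∎))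
      where
      open ≡-Reasoning
      zeros : ∣ z₁ ∣ ≡ 0 × ∣ z₂ ∣ ≡ 0 × ∣ z₃ ∣ ≡ 0 × ∣ z₄ ∣ ≡ 0
      zeros = sumOfSquares≡0 (∣ z₁ ∣) (∣ z₂ ∣) (∣ z₃ ∣) (∣ z₄ ∣) (trans (sym Mr≡s) (trans (cong (M ℕ.*_) r≡0) (ℕ.*-zeroʳ M)))
      z₁≡0 : z₁ ≡ + 0
      z₂≡0 : z₂ ≡ + 0
      z₃≡0 : z₃ ≡ + 0
      z₄≡0 : z₄ ≡ + 0
      z₁≡0 = ℤ.∣i∣≡0⇒i≡0 (proj₁ zeros)
      z₂≡0 = ℤ.∣i∣≡0⇒i≡0 (proj₁ (proj₂ zeros))
      z₃≡0 = ℤ.∣i∣≡0⇒i≡0 (proj₁ (proj₂ (proj₂ zeros)))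
      z₄≡0 = ℤ.∣i∣≡0⇒i≡0 (proj₂ (proj₂ (proj₂ zeros)))
      square : ∀ q {z} → z ≡ + 0 → (q * + M + z) * (q * + M + z) ≡ (q * + M + + 0) * (q * + M + + 0)
      square _ refl = refl
      multiples : ∀ m q₁ q₂ q₃ q₄ → (q₁ * m + + 0) * (q₁ * m + + 0) + (q₂ * m + + 0) * (q₂ * m + + 0)
                                   + (q₃ * m + + 0) * (q₃ * m + + 0) + (q₄ * m + + 0) * (q₄ * m + + 0)
                                   ≡ m * (m * (q₁ * q₁ + q₂ * q₂ + q₃ * q₃ + q₄ * q₄))
      multiples = solve-∀

    r≢M : r ≢ M
    r≢M r≡M = ¬nontrivialFactor (proj₁ divisible) 1<M M<p
      (ℤ.*-cancelˡ-≡ (+ M) _ _ (trans (sym sumSq₄-y) (proj₂ divisible)))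
      where
      quarters : a₁ ℕ.* 4 ≡ M ℕ.* M × a₂ ℕ.* 4 ≡ M ℕ.* M × a₃ ℕ.* 4 ≡ M ℕ.* M × a₄ ℕ.* 4 ≡ M ℕ.* M
      quarters = quarters≤∧sum≡⇒quarters≡ a₁ a₂ a₃ a₄ 4a₁≤M² 4a₂≤M² 4a₃≤M² 4a₄≤M²
                   (trans (sym Mr≡s) (cong (M ℕ.*_) r≡M))
      divisible : Σ ℤ λ K → sumSq₄ y₁ y₂ y₃ y₄ ≡ + M * (+ M * K)
      divisible = halfOddMultiples⇒sumSq₄≡M²K q₁ q₂ q₃ q₄
        (4*square≡⇒double≡ {∣ z₁ ∣} (proj₁ quarters))
        (4*square≡⇒double≡ {∣ z₂ ∣} (proj₁ (proj₂ quarters)))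
        (4*square≡⇒double≡ {∣ z₃ ∣} (proj₁ (proj₂ (proj₂ quarters))))
        (4*square≡⇒double≡ {∣ z₄ ∣} (proj₂ (proj₂ (proj₂ quarters))))

    smallerMultiple : Σ ℕ λ r → 1 ℕ.≤ r × r ℕ.< M × FourSquares (+ r * P)
    smallerMultiple = r , ℕ.n≢0⇒n>0 r≢0 , ℕ.≤∧≢⇒< r≤M r≢M ,
      fourSquares V₁ V₂ V₃ V₄ (trans sumSq₄-V≡RP (cong (_* P) R≡r))

  reduce : ∀ {M} → 1 ℕ.< M → M ℕ.< p → FourSquares (+ M * P) →
    Σ ℕ λ r → 1 ℕ.≤ r × r ℕ.< M × FourSquares (+ r * P)
  reduce {M@(suc _)} 1<M M<p (fourSquares y₁ y₂ y₃ y₄ sumSq₄-y)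
    with balancedDivide y₁ M | balancedDivide y₂ M | balancedDivide y₃ M | balancedDivide y₄ M
  ... | balancedDivision q₁ z₁ refl b₁ | balancedDivision q₂ z₂ refl b₂
      | balancedDivision q₃ z₃ refl b₃ | balancedDivision q₄ z₄ refl b₄
      = DescentStep.smallerMultiple 1<M M<p q₁ q₂ q₃ q₄ z₁ z₂ z₃ z₄ b₁ b₂ b₃ b₄ sumSq₄-y

  descent : ∀ m → Acc ℕ._<_ m → 1 ℕ.≤ m → m ℕ.< p → FourSquares (+ m * P) → FourSquares P
  descent (suc zero) _ _ _ squares = subst FourSquares (ℤ.*-identityˡ P) squares
  descent m@(suc (suc _)) (acc smaller) _ m<p squares
    with r , 1≤r , r<m , squares′ ← reduce (s≤s (s≤s z≤n)) m<p squares
    = descent r (smaller r<m) 1≤r (ℕ.<-trans r<m m<p) squares′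

  fourSquares-prime : FourSquares P
  fourSquares-prime with smallMultiple x y m 0<m m<p x²+y²+1≡mp ← smallMultiple-of-prime p-prime
    = descent m (<-wellFounded m) 0<m m<p (fourSquares (+ x) (+ y) (+ 1) (+ 0) sumSq₄≡mP)
    where
    sumSq₄≡mP : sumSq₄ (+ x) (+ y) (+ 1) (+ 0) ≡ + m * P
    sumSq₄≡mP = trans (sumSq₄-abs (+ x) (+ y) (+ 1) (+ 0))
      (trans (cong +_ (trans (ℕ.+-identityʳ _) x²+y²+1≡mp)) (ℤ.pos-* m p))

lagrange-four-squares : ∀ n → FourSquares (+ n)
lagrange-four-squares n = go n (<-wellFounded n)
  where
  go : ∀ n → Acc ℕ._<_ n → FourSquares (+ n)
  go zero _ = fourSquares (+ 0) (+ 0) (+ 0) (+ 0) refl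
  go (suc zero) _ = fourSquares (+ 1) (+ 0) (+ 0) (+ 0) refl
  go n@(suc (suc _)) (acc smaller) with composite? n
  ... | yes (hasNonTrivialDivisor {d} d<n d∣n@(divides q n≡qd)) =
        subst FourSquares (trans (sym (ℤ.pos-* q d)) (cong +_ (sym n≡qd)))
          (fourSquares-* (go q (smaller (quotient-< d∣n))) (go d (smaller d<n)))
  ... | no ¬composite = fourSquares-prime (¬composite⇒prime ¬composite)

-- Padding a Diophantine equation

rename : ∀ {m n} → (Fin m → Fin n) → Poly m → Poly n
rename ρ (const c) = const c
rename ρ (var i)   = var (ρ i)
rename ρ (p ⊕ q)   = rename ρ p ⊕ rename ρ q
rename ρ (p ⊗ q)   = rename ρ p ⊗ rename ρ q

eval-rename : ∀ {m n} (ρ : Fin m → Fin n) {x : Vec ℤ m} {y : Vec ℤ n} →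
  (∀ i → lookup y (ρ i) ≡ lookup x i) → ∀ p → eval (rename ρ p) y ≡ eval p x
eval-rename ρ ρ-ok (const c) = refl
eval-rename ρ ρ-ok (var i)   = ρ-ok i
eval-rename ρ ρ-ok (p ⊕ q)   = cong₂ _+_ (eval-rename ρ ρ-ok p) (eval-rename ρ ρ-ok q)
eval-rename ρ ρ-ok (p ⊗ q)   = cong₂ _*_ (eval-rename ρ ρ-ok p) (eval-rename ρ ρ-ok q)

normSq : ∀ {n} → Vec ℤ n → ℕ
normSq []      = 0
normSq (a ∷ x) = ∣ a ∣ ℕ.* ∣ a ∣ ℕ.+ normSq x

sumOfSquares : ∀ n → Poly n
sumOfSquares zero    = const (+ 0)
sumOfSquares (suc n) = (var Fin.zero ⊗ var Fin.zero) ⊕ rename Fin.suc (sumOfSquares n)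

eval-sumOfSquares : ∀ {n} (x : Vec ℤ n) → eval (sumOfSquares n) x ≡ + normSq x
eval-sumOfSquares []      = refl
eval-sumOfSquares {suc n} (a ∷ x) = begin
  a * a + eval (rename Fin.suc (sumOfSquares n)) (a ∷ x)
    ≡⟨ cong₂ _+_ (i*i≡∣i∣*∣i∣ a) (eval-rename Fin.suc {x} {a ∷ x} (λ _ → refl) (sumOfSquares n)) ⟩
  + (∣ a ∣ ℕ.* ∣ a ∣) + eval (sumOfSquares n) x
    ≡⟨ cong (ℤ._+_ (+ (∣ a ∣ ℕ.* ∣ a ∣))) (eval-sumOfSquares x) ⟩
  + (∣ a ∣ ℕ.* ∣ a ∣) + + normSq x
    ≡⟨ sym (ℤ.pos-+ (∣ a ∣ ℕ.* ∣ a ∣) (normSq x)) ⟩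
  + normSq (a ∷ x) ∎
  where open ≡-Reasoning

weight : ∀ {n} → Vec ℤ n → ℕ
weight {n} x = normSq x ℕ.+ n ℕ.* n

weightPoly : ∀ n → Poly n
weightPoly n = sumOfSquares n ⊕ const (+ (n ℕ.* n))

eval-weightPoly : ∀ {n} (x : Vec ℤ n) → eval (weightPoly n) x ≡ + weight x
eval-weightPoly {n} x = trans (cong (_+ + (n ℕ.* n)) (eval-sumOfSquares x)) (sym (ℤ.pos-+ (normSq x) (n ℕ.* n)))

square : ∀ {n} → Poly n → Poly n
square p = p ⊗ p

padded : DiophantineEq → DiophantineEq
padded (dioph n D) = dioph (5 ℕ.+ n)
  (square (rename (5 ↑ʳ_) D) ⊕ square (rename (5 ↑ʳ_) (weightPoly n) ⊕ (const (- + 1) ⊗ rename (_↑ˡ n) (sumOfSquares 5))))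

eval-padded : ∀ {n} (D : Poly n) (w : Vec ℤ 5) x → let d = eval D x; e = + weight x + - + 1 * + normSq w in
  eval (poly (padded (dioph n D))) (w ++ x) ≡ d * d + e * e
eval-padded {n} D w x
  rewrite eval-rename (5 ↑ʳ_) {x} {w ++ x} (Vec.lookup-++ʳ w x) D
        | eval-rename (5 ↑ʳ_) {x} {w ++ x} (Vec.lookup-++ʳ w x) (weightPoly n)
        | eval-rename (_↑ˡ n) {w} {w ++ x} (Vec.lookup-++ˡ w x) (sumOfSquares 5)
        | eval-weightPoly x
        | eval-sumOfSquares w
  = refl

sumOfTwoSquares≡0 : ∀ i j → i * i + j * j ≡ + 0 → i ≡ + 0 × j ≡ + 0
sumOfTwoSquares≡0 i j eq = square≡0 i (ℕ.m+n≡0⇒m≡0 _ eq′) , square≡0 j (ℕ.m+n≡0⇒n≡0 (∣ i ∣ ℕ.* ∣ i ∣) eq′)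
  where
  eq′ : ∣ i ∣ ℕ.* ∣ i ∣ ℕ.+ ∣ j ∣ ℕ.* ∣ j ∣ ≡ 0
  eq′ = ℤ.+-injective (trans (ℤ.pos-+ (∣ i ∣ ℕ.* ∣ i ∣) (∣ j ∣ ℕ.* ∣ j ∣)) (trans (sym (cong₂ _+_ (i*i≡∣i∣*∣i∣ i) (i*i≡∣i∣*∣i∣ j))) eq))
  square≡0 : ∀ k → ∣ k ∣ ℕ.* ∣ k ∣ ≡ 0 → k ≡ + 0
  square≡0 k eq with ℕ.m*n≡0⇒m≡0∨n≡0 ∣ k ∣ eq
  ... | inj₁ ∣k∣≡0 = ℤ.∣i∣≡0⇒i≡0 ∣k∣≡0
  ... | inj₂ ∣k∣≡0 = ℤ.∣i∣≡0⇒i≡0 ∣k∣≡0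

padded-solution⇔ : ∀ {n} (D : Poly n) (w : Vec ℤ 5) x →
  IsSolution (padded (dioph n D)) (w ++ x) ⇔ (IsSolution (dioph n D) x × normSq w ≡ weight x)
padded-solution⇔ D w x = mk⇔ to from
  where
  W S : ℤ
  W = + weight x
  S = + normSq w
  difference : ∀ W S → S ≡ W + - + 1 * (W + - + 1 * S)
  difference = solve-∀
  vanishes : ∀ W → + 0 * + 0 + (W + - + 1 * W) * (W + - + 1 * W) ≡ + 0
  vanishes = solve-∀
  to : IsSolution (padded (dioph _ D)) (w ++ x) → IsSolution (dioph _ D) x × normSq w ≡ weight x
  to sol with sumOfTwoSquares≡0 (eval D x) (W + - + 1 * S) (trans (sym (eval-padded D w x)) sol)
  ... | D≡0 , e≡0 = D≡0 , ℤ.+-injective (trans (difference W S) (trans (cong (λ e → W + - + 1 * e) e≡0) (ℤ.+-identityʳ W)))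
  from : IsSolution (dioph _ D) x × normSq w ≡ weight x → IsSolution (padded (dioph _ D)) (w ++ x)
  from (D≡0 , S≡W) rewrite eval-padded D w x | D≡0 | S≡W = vanishes W

range : ℕ → List ℤ
range B = map +_ (upTo (suc B)) List.++ map -[1+_] (upTo B)

∈-range : ∀ {B z} → ∣ z ∣ ℕ.≤ B → z ∈ range B
∈-range {B} {+ k}      k≤B = ∈.∈-++⁺ˡ (∈.∈-map⁺ +_ (∈.∈-upTo⁺ (s≤s k≤B)))
∈-range {B} { -[1+ k ]} k<B = ∈.∈-++⁺ʳ (map +_ (upTo (suc B))) (∈.∈-map⁺ -[1+_] (∈.∈-upTo⁺ k<B))

vectorsOver : ∀ {A : Set} → List A → (m : ℕ) → List (Vec A m)
vectorsOver xs zero    = [] List.∷ List.[]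
vectorsOver xs (suc m) = cartesianProductWith _∷_ xs (vectorsOver xs m)

∈-vectorsOver : ∀ {A : Set} {xs : List A} {m} {v : Vec A m} → All (_∈ xs) v → v ∈ vectorsOver xs m
∈-vectorsOver []         = here refl
∈-vectorsOver (a∈ ∷ v∈) = ∈.∈-cartesianProductWith⁺ _∷_ a∈ (∈-vectorsOver v∈)

normSq≤⇒entries≤ : ∀ {n} (x : Vec ℤ n) {B} → normSq x ℕ.≤ B → All (λ a → ∣ a ∣ ℕ.≤ B) x
normSq≤⇒entries≤ []      _  = []
normSq≤⇒entries≤ (a ∷ x) ≤B =
  ℕ.≤-trans (n≤n*n ∣ a ∣) (ℕ.≤-trans (ℕ.m≤m+n _ (normSq x)) ≤B) ∷
  normSq≤⇒entries≤ x (ℕ.≤-trans (ℕ.m≤n+m (normSq x) _) ≤B)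

weight≤sum : ∀ {n} {x : Vec ℤ n} {L} → x ∈ L → weight x ℕ.≤ sum (map weight L)
weight≤sum (here refl)               = ℕ.m≤m+n _ _
weight≤sum {L = y List.∷ L} (there x∈L) = ℕ.≤-trans (weight≤sum x∈L) (ℕ.m≤n+m _ (weight y))

padded-finite : ∀ E → FinitelyManySolutions E → FinitelyManySolutions (padded E)
padded-finite E@(dioph n D) (L , _ , solution⇔∈L) =
  L′ , Unique.deduplicate-! _≟ᵥ_ _ , λ v → mk⇔
    (λ sol → ∈.∈-deduplicate⁺ _≟ᵥ_ (∈.∈-filter⁺ solution? (∈-vectorsOver (All.map ∈-range (bounded v sol))) sol))
    (λ v∈L′ → proj₂ (∈.∈-filter⁻ solution? {xs = candidates} (∈.∈-deduplicate⁻ _≟ᵥ_ (filter solution? candidates) v∈L′)))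
  where
  _≟ᵥ_ : DecidableEquality (Vec ℤ (5 ℕ.+ n))
  _≟ᵥ_ = Vec.≡-dec ℤ._≟_
  B : ℕ
  B = sum (map weight L)
  solution? : (v : Vec ℤ (5 ℕ.+ n)) → Dec (IsSolution (padded E) v)
  solution? v = eval (poly (padded E)) v ℤ.≟ + 0
  candidates L′ : List (Vec ℤ (5 ℕ.+ n))
  candidates = vectorsOver (range B) (5 ℕ.+ n)
  L′ = deduplicate _≟ᵥ_ (filter solution? candidates)
  bounded : ∀ v → IsSolution (padded E) v → All (λ a → ∣ a ∣ ℕ.≤ B) v
  bounded v sol with w , x , refl ← Vec.splitAt 5 v
    with D≡0 , normSq-w≡weight ← Equivalence.to (padded-solution⇔ D w x) sol
    = All.++⁺ (normSq≤⇒entries≤ w (ℕ.≤-trans (ℕ.≤-reflexive normSq-w≡weight) weight≤B))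
              (normSq≤⇒entries≤ x (ℕ.≤-trans (ℕ.m≤m+n (normSq x) (n ℕ.* n)) weight≤B))
    where
    weight≤B : weight x ℕ.≤ B
    weight≤B = weight≤sum (Equivalence.to (solution⇔∈L x) D≡0)

maxAbs²≤ : ∀ {m} b (x : Vec ℤ m) → let h = foldr _ (λ a k → ∣ a ∣ ⊔ k) b x in h ℕ.* h ℕ.≤ normSq x ℕ.+ b ℕ.* b
maxAbs²≤ b []      = ℕ.≤-refl
maxAbs²≤ b (a ∷ x) = begin
  (∣ a ∣ ⊔ h) ℕ.* (∣ a ∣ ⊔ h)                   ≤⟨ ⊔-square≤ ∣ a ∣ h ⟩
  ∣ a ∣ ℕ.* ∣ a ∣ ℕ.+ h ℕ.* h                   ≤⟨ ℕ.+-monoʳ-≤ (∣ a ∣ ℕ.* ∣ a ∣) (maxAbs²≤ b x) ⟩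
  ∣ a ∣ ℕ.* ∣ a ∣ ℕ.+ (normSq x ℕ.+ b ℕ.* b)    ≡⟨ sym (ℕ.+-assoc (∣ a ∣ ℕ.* ∣ a ∣) (normSq x) (b ℕ.* b)) ⟩
  normSq (a ∷ x) ℕ.+ b ℕ.* b                    ∎
  where
  open ℕ.≤-Reasoning
  h : ℕ
  h = foldr _ (λ a k → ∣ a ∣ ⊔ k) b x

height²≤weight : ∀ {n} (x : Vec ℤ n) → height x ℕ.* height x ℕ.≤ weight x
height²≤weight {n} x = maxAbs²≤ n x

fourSquaresVec : ∀ {n} → FourSquares n → Vec ℤ 4
fourSquaresVec (fourSquares a b c d _) = a ∷ b ∷ c ∷ d ∷ []

normSq-fourSquaresVec : ∀ {n} (s : FourSquares (+ n)) → normSq (fourSquaresVec s) ≡ n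
normSq-fourSquaresVec (fourSquares a b c d sumSq₄≡) =
  trans (reassociate (∣ a ∣ ℕ.* ∣ a ∣) (∣ b ∣ ℕ.* ∣ b ∣) (∣ c ∣ ℕ.* ∣ c ∣) (∣ d ∣ ℕ.* ∣ d ∣))
        (ℤ.+-injective (trans (sym (sumSq₄-abs a b c d)) sumSq₄≡))
  where
  reassociate : ∀ a b c d → a ℕ.+ (b ℕ.+ (c ℕ.+ (d ℕ.+ 0))) ≡ a ℕ.+ b ℕ.+ c ℕ.+ d
  reassociate = ℕ-Solver.solve-∀

injection⇒≤length : ∀ {A : Set} {m} {f : Fin m → A} → (∀ {i j} → f i ≡ f j → i ≡ j) →
  ∀ L → (∀ i → f i ∈ L) → m ℕ.≤ length L
injection⇒≤length {f = f} f-injective L f∈L = Fin.injective⇒≤ index-injective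
  where
  index-injective : ∀ {i j} → Any.index (f∈L i) ≡ Any.index (f∈L j) → i ≡ j
  index-injective {i} {j} eq = f-injective
    (trans (Any.lookup-index (f∈L i)) (trans (cong (List.lookup L) eq) (sym (Any.lookup-index (f∈L j)))))

height<#padded-solutions : ∀ {n} (D : Poly n) L′ → Enumerates (padded (dioph n D)) L′ →
  ∀ x → IsSolution (dioph n D) x → height x ℕ.< length L′
height<#padded-solutions {n} D L′ (_ , solution⇔∈L′) x sol =
  injection⇒≤length witness-injective L′ (λ k → Equivalence.to (solution⇔∈L′ (witness k)) (witness-solution k))
  where
  h : ℕ
  h = height x
  k²≤weight : (k : Fin (suc h)) → toℕ k ℕ.* toℕ k ℕ.≤ weight x
  k²≤weight k = ℕ.≤-trans (ℕ.*-mono-≤ k≤h k≤h) (height²≤weight x)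
    where
    k≤h : toℕ k ℕ.≤ h
    k≤h = Fin.toℕ≤pred[n] k
  rest : Fin (suc h) → Vec ℤ 4
  rest k = fourSquaresVec (lagrange-four-squares (weight x ℕ.∸ toℕ k ℕ.* toℕ k))
  witness : Fin (suc h) → Vec ℤ (5 ℕ.+ n)
  witness k = (+ toℕ k ∷ rest k) ++ x
  witness-solution : ∀ k → IsSolution (padded (dioph n D)) (witness k)
  witness-solution k = Equivalence.from (padded-solution⇔ D (+ toℕ k ∷ rest k) x)
    (sol , trans (cong (toℕ k ℕ.* toℕ k ℕ.+_) (normSq-fourSquaresVec (lagrange-four-squares _)))
                 (ℕ.m+[n∸m]≡n (k²≤weight k)))
  witness-injective : ∀ {i j} → witness i ≡ witness j → i ≡ j
  witness-injective eq = Fin.toℕ-injective (ℤ.+-injective (cong Vec.head eq))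

theorem5 : (f : DiophantineEq → ℤ)
    → (∀ E L → Enumerates E L → + (length L) < f E)
    → Σ (DiophantineEq → ℤ) λ g →
        ∀ E → FinitelyManySolutions E →
          ∀ (x : Vec ℤ (nvars E)) → IsSolution E x → + (height x) < g E
theorem5 f f-bound = f ∘ padded , bound
  where
  bound : ∀ E → FinitelyManySolutions E → ∀ x → IsSolution E x → + height x < f (padded E)
  bound E@(dioph _ D) finite x sol with L′ , enumerates ← padded-finite E finite =
    ℤ.<-trans (ℤ.+<+ (height<#padded-solutions D L′ enumerates x sol)) (f-bound (padded E) L′ enumerates)
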